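{- Let $\Delta$ be a 3-colored simplicial complex with $f_{12}(\Delta)\le f_{13}(\Delta)$ and $f_{12}(\Delta)\le f_{23}(\Delta)$. Suppose there is $\Gamma_0\in\mathcal{F}(\Delta)$ with $g_1(\Gamma_0)=b_1(\Delta)$ and $r(\Gamma_0)=2$. Then there is $\Gamma\in\mathcal{F}(\Delta)$ such that $f_{123}(\Gamma)\ge v(\Delta,g_2(\Gamma_0))-f_{12}(\Delta)$.
   Context: A 3-colored simplicial complex is a finite simplicial complex with a coloring of its vertices by $[3]=\{1,2,3\}$ such that no face contains two vertices of the same color. $f_S(\Delta)$ is the number of faces with color set exactly $S\subseteq[3]$ (written $f_1,f_{12},f_{123}$, etc.; $f_{ij}=f_{\{i,j\}}$). Faces with color set $[3]$ are facets. Complexes are assumed to have $f_S>0$ for all $S$. Vertices of color $i$ are labeled $v^i_1,v^i_2,\dots$. Define $b_1(\Delta)=\lfloor\sqrt{f_{12}f_{13}/f_{23}}\rfloor$, $b_2(\Delta)=\lfloor\sqrt{f_{12}f_{23}/f_{13}}\rfloor$, $b_3(\Delta)=\lfloor\sqrt{f_{13}f_{23}/f_{12}}\rfloor$ (all $f$'s of $\Delta$), and for $t>0$, $v(\Delta,t)=b_1(\Delta)f_{23}(\Delta)+(f_{12}(\Delta)-b_1(\Delta)t)\big(f_{13}(\Delta)-b_1(\Delta)f_{23}(\Delta)/t\big)$. Construction: given $\Delta$, positive integers $g_1,g_2,g_3$ and distinct $p,q\in[3]$, build $\Gamma$ as follows. Start with vertices $v^i_1,\dots,v^i_{g_i}$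 for each $i$, every two of distinct colors adjacent. If $f_p(\Delta)>g_p$, add $v^p_{g_p+1}$ and, for each color $c\ne p$, join it to the first $k_c$ present vertices of color $c$, with $k_c$ as large as possible so that the number of edges of color set $\{p,c\}$ does not exceed $f_{pc}(\Delta)$. Then, if $f_q(\Delta)>g_q$, add $v^q_{g_q+1}$ and join it in the same way (the present vertices of color $p$ including $v^p_{g_p+1}$ if added). Faces: empty set, vertices, edges, all triples of pairwise adjacent vertices. Write $g_i(\Gamma),p(\Gamma),q(\Gamma)$ for the parameters and $r(\Gamma)=6-p(\Gamma)-q(\Gamma)$. $\mathcal{A}(\Delta)$ is the set of all complexes (with parameters) so constructed that are well defined and satisfy $f_S(\Gamma)\le f_S(\Delta)$ for all $S\ne[3]$. $m(\Delta)=\max\{f_{123}(\Gamma):\Gamma\in\mathcal{A}(\Delta)\}$; $\mathcal{B}(\Delta)=\{\Gamma\in\mathcal{A}(\Delta):f_{123}(\Gamma)=m(\Delta)\}$; $n(\Delta)=\max\{f_{12}(\Gamma)+f_{13}(\Gamma)+f_{23}(\Gamma):\Gamma\in\mathcal{B}(\Delta)\}$; $\mathcal{C}(\Delta)=\{\Gamma\in\mathcal{B}(\Delta):f_{12}(\Gamma)+f_{13}(\Gamma)+f_{23}(\Gamma)=n(\Delta)\}$; $\mathcal{D}(\Delta)=\{\Gamma\in\mathcal{C}(\Delta): f_{123}(\Gamma)<\min\{f_1(\Delta)f_{23}(\Delta),f_2(\Delta)f_{13}(\Delta),f_3(\Delta)f_{12}(\Delta)\}\}$. $\mathcal{F}(\Delta)$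 is the set of $\Gamma$ such that $\Gamma\in\mathcal{A}(\Delta)$, $f_{12}(\Gamma)+f_{13}(\Gamma)+f_{23}(\Gamma)=f_{12}(\Delta)+f_{13}(\Delta)+f_{23}(\Delta)$, $\mathcal{D}(\Delta)\neq\emptyset$, and $g_i(\Gamma)=b_i(\Delta)$ for some $i\in[3]$. -}

module Defs where

open import Data.Nat as ℕ using (ℕ; zero; suc; _+_; _*_; _∸_; _≤_; _<_; _⊔_; _⊓_; _<ᵇ_; _≡ᵇ_)
open import Data.Bool using (Bool; true; false; T; _∧_; _∨_; if_then_else_)
open import Data.Fin using (Fin; toℕ; zero; suc)
open import Data.Product using (_×_; _,_; ∃-syntax; Σ-syntax)
open import Data.Sum using (_⊎_)
open import Relation.Binary.PropositionalEquality using (_≡_; _≢_)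
open import Data.Integer as ℤ using (ℤ; +_)
open import Data.Rational as ℚ using (ℚ)

sumFin : (n : ℕ) → (Fin n → ℕ) → ℕ
sumFin zero    f = 0
sumFin (suc n) f = f zero + sumFin n (λ i → f (suc i))

b2n : Bool → ℕ
b2n true  = 1
b2n false = 0

-- Colors 1,2,3 ; vertices of color i are Fin (nᵢ) (v^i_{j+1} ↔ j).
-- Faces: the empty face, every vertex, the edges of color set {i,j}
-- marked by eᵢⱼ, and the triangles (facets) marked by t.
-- A face can contain at most one vertex of each color, so this is
-- exactly a properly 3-colored finite simplicial complex; 'closed'
-- says the complex is closed under taking subsets.

T3 : Bool → Bool → Bool → Set
T3 a b c = T a × T b × T c

record Complex3 : Set where
  field
    n1 n2 n3 : ℕ
    e12 : Fin n1 → Fin n2 → Bool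
    e13 : Fin n1 → Fin n3 → Bool
    e23 : Fin n2 → Fin n3 → Bool
    t   : Fin n1 → Fin n2 → Fin n3 → Bool
    closed : ∀ a b c → T (t a b c) → T3 (e12 a b) (e13 a c) (e23 b c)

open Complex3 public

f1 f2 f3 f12 f13 f23 f123 : Complex3 → ℕ
f1 Δ = n1 Δ
f2 Δ = n2 Δ
f3 Δ = n3 Δ
f12 Δ = sumFin (n1 Δ) λ a → sumFin (n2 Δ) λ b → b2n (e12 Δ a b)
f13 Δ = sumFin (n1 Δ) λ a → sumFin (n3 Δ) λ c → b2n (e13 Δ a c)
f23 Δ = sumFin (n2 Δ) λ b → sumFin (n3 Δ) λ c → b2n (e23 Δ b c)
f123 Δ = sumFin (n1 Δ) λ a → sumFin (n2 Δ) λ b → sumFin (n3 Δ) λ c → b2n (t Δ a b c)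

-- f_i for a color (Fin 3: zero ↔ color 1, etc.)
fv : Complex3 → Fin 3 → ℕ
fv Δ zero = f1 Δ
fv Δ (suc zero) = f2 Δ
fv Δ (suc (suc zero)) = f3 Δ

-- f_{ij} for a pair of colors (diagonal values are never used)
fe : Complex3 → Fin 3 → Fin 3 → ℕ
fe Δ zero (suc zero) = f12 Δ
fe Δ (suc zero) zero = f12 Δ
fe Δ zero (suc (suc zero)) = f13 Δ
fe Δ (suc (suc zero)) zero = f13 Δ
fe Δ (suc zero) (suc (suc zero)) = f23 Δ
fe Δ (suc (suc zero)) (suc zero) = f23 Δ
fe Δ _ _ = 0

Positive : Complex3 → Set
Positive Δ = 0 < f1 Δ × 0 < f2 Δ × 0 < f3 Δ × 0 < f12 Δ × 0 < f13 Δ × 0 < f23 Δ × 0 < f123 Δ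

-- b_i(Δ) = ⌊ √(n/d) ⌋, i.e. the largest b with b·b·d ≤ n (for d > 0;
-- such b satisfies b ≤ n, so searching below n suffices).

floorSqrtFracFrom : ℕ → ℕ → ℕ → ℕ
floorSqrtFracFrom n d zero = 0
floorSqrtFracFrom n d (suc k) =
  if (suc k * suc k * d) ℕ.≤ᵇ n then suc k else floorSqrtFracFrom n d k

floorSqrtFrac : ℕ → ℕ → ℕ
floorSqrtFrac n d = floorSqrtFracFrom n d n

b1 b2 b3 : Complex3 → ℕ
b1 Δ = floorSqrtFrac (f12 Δ * f13 Δ) (f23 Δ)
b2 Δ = floorSqrtFrac (f12 Δ * f23 Δ) (f13 Δ)
b3 Δ = floorSqrtFrac (f13 Δ * f23 Δ) (f12 Δ)

bc : Complex3 → Fin 3 → ℕ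
bc Δ zero = b1 Δ
bc Δ (suc zero) = b2 Δ
bc Δ (suc (suc zero)) = b3 Δ

-- v(Δ,t) = b₁ f₂₃ + (f₁₂ - b₁ t)(f₁₃ - b₁ f₂₃ / t), a rational number.
-- Only used for t > 0; the value at t = 0 is an irrelevant junk value.

ℕ→ℚ : ℕ → ℚ
ℕ→ℚ n = (+ n) ℚ./ 1

v : Complex3 → ℕ → ℚ
v Δ zero = 0ℚ' where
  0ℚ' : ℚ
  0ℚ' = ℚ.0ℚ
v Δ (suc t') =
  ℕ→ℚ (b1 Δ * f23 Δ)
  ℚ.+ (ℕ→ℚ (f12 Δ) ℚ.- ℕ→ℚ (b1 Δ * suc t'))
      ℚ.* (ℕ→ℚ (f13 Δ) ℚ.- ((+ (b1 Δ * f23 Δ)) ℚ./ suc t'))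

record Params : Set where
  constructor params
  field
    g : Fin 3 → ℕ
    p q : Fin 3

open Params public

g1 g2 g3 : Params → ℕ
g1 P = g P zero
g2 P = g P (suc zero)
g3 P = g P (suc (suc zero))

-- r(Γ) = 6 - p - q with colors numbered 1,2,3
r : Params → ℕ
r P = 6 ∸ suc (toℕ (p P)) ∸ suc (toℕ (q P))

_==_ : Fin 3 → Fin 3 → Bool
a == b = toℕ a ≡ᵇ toℕ b

module Construction (Δ : Complex3) (P : Params) where
  private
    gp = g P (p P)
    gq = g P (q P)

  -- is v^p_{g_p+1} added? is v^q_{g_q+1} added?
  addP addQ : Bool
  addP = g P (p P) <ᵇ fv Δ (p P)
  addQ = g P (q P) <ᵇ fv Δ (q P)

  -- first step: v^p_{g_p+1} joined to the first kP c vertices of color c.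
  -- Edges of color {p,c} with k: g_p g_c + k; the largest admissible
  -- k ≤ g_c is min(g_c, f_pc(Δ) - g_p g_c) (requires g_p g_c ≤ f_pc(Δ)).
  kP : Fin 3 → ℕ
  kP c = g P c ⊓ (fe Δ (p P) c ∸ gp * g P c)

  -- second step: present vertices of color c and current {q,c}-edges
  presQ : Fin 3 → ℕ
  presQ c = g P c + b2n ((c == p P) ∧ addP)

  curQ : Fin 3 → ℕ
  curQ c = gq * g P c + (if (c == p P) ∧ addP then kP (q P) else 0)

  kQ : Fin 3 → ℕ
  kQ c = presQ c ⊓ (fe Δ (q P) c ∸ curQ c)

  -- the construction is well defined: some k (e.g. k = 0) is admissible
  WellDefined : Set
  WellDefined =
    (T addP → ∀ c → c ≢ p P → gp * g P c ≤ fe Δ (p P) c) ×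
    (T addQ → ∀ c → c ≢ q P → curQ c ≤ fe Δ (q P) c)

  nv : Fin 3 → ℕ
  nv c = g P c + b2n ((c == p P) ∧ addP) + b2n ((c == q P) ∧ addQ)

  adj : Fin 3 → Fin 3 → ℕ → ℕ → Bool
  adj a b x y =
    ((x <ᵇ g P a) ∧ (y <ᵇ g P b))
    ∨ (addP ∧ (a == p P) ∧ (x ≡ᵇ gp) ∧ (y <ᵇ kP b))
    ∨ (addP ∧ (b == p P) ∧ (y ≡ᵇ gp) ∧ (x <ᵇ kP a))
    ∨ (addQ ∧ (a == q P) ∧ (x ≡ᵇ gq) ∧ (y <ᵇ kQ b))
    ∨ (addQ ∧ (b == q P) ∧ (y ≡ᵇ gq) ∧ (x <ᵇ kQ a))

  private
    c1 c2 c3 : Fin 3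
    c1 = zero
    c2 = suc zero
    c3 = suc (suc zero)

    closure : ∀ x y z → T (x ∧ y ∧ z) → T3 x y z
    closure true true true _ = _ , _ , _

  Γ : Complex3
  Γ = record
    { n1 = nv c1 ; n2 = nv c2 ; n3 = nv c3
    ; e12 = λ a b → adj c1 c2 (toℕ a) (toℕ b)
    ; e13 = λ a c → adj c1 c3 (toℕ a) (toℕ c)
    ; e23 = λ b c → adj c2 c3 (toℕ b) (toℕ c)
    ; t = λ a b c → adj c1 c2 (toℕ a) (toℕ b) ∧ adj c1 c3 (toℕ a) (toℕ c)
                      ∧ adj c2 c3 (toℕ b) (toℕ c)
    ; closed = λ a b c → closure _ _ _
    }

Γ[_,_] : Complex3 → Params → Complex3
Γ[ Δ , P ] = Construction.Γ Δ P

esum : Complex3 → ℕ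
esum Γ = f12 Γ + f13 Γ + f23 Γ

-- The families 𝒜, ℬ, 𝒞, 𝒟, ℱ (elements are parameter tuples; the
-- complex is Γ[ Δ , P ]).

InA : Complex3 → Params → Set
InA Δ P =
  (0 < g1 P × 0 < g2 P × 0 < g3 P) × p P ≢ q P ×
  Construction.WellDefined Δ P ×
  (f1 G ≤ f1 Δ × f2 G ≤ f2 Δ × f3 G ≤ f3 Δ ×
   f12 G ≤ f12 Δ × f13 G ≤ f13 Δ × f23 G ≤ f23 Δ)
  where G = Γ[ Δ , P ]

InB : Complex3 → Params → Set
InB Δ P = InA Δ P × (∀ P' → InA Δ P' → f123 Γ[ Δ , P' ] ≤ f123 Γ[ Δ , P ])

InC : Complex3 → Params → Set
InC Δ P = InB Δ P × (∀ P' → InB Δ P' → esum Γ[ Δ , P' ] ≤ esum Γ[ Δ , P ])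

InD : Complex3 → Params → Set
InD Δ P = InC Δ P ×
  f123 Γ[ Δ , P ] < (f1 Δ * f23 Δ) ⊓ (f2 Δ * f13 Δ) ⊓ (f3 Δ * f12 Δ)

InF : Complex3 → Params → Set
InF Δ P = InA Δ P × esum Γ[ Δ , P ] ≡ esum Δ × (∃[ P' ] InD Δ P') ×
  (∃[ i ] g P i ≡ bc Δ i)

-- The witness is Γ₀ itself. Membership in ℱ makes the edge numbers of Γ₀ equal
-- to those of Δ, and r(Γ₀) = 2 means the added vertices have colours 1 and 3.
-- So Γ₀ is the complete b × t × s block (b = b₁(Δ), t = g₂, s = g₃) plus
-- possibly a colour-1 vertex, with X neighbours of colour 2 and Z among the
-- first s of colour 3, and possibly a colour-3 vertex. Hence f₁₂ = bt + X,
-- ts ≤ f₂₃ = ts + y ≤ t(s + 1), f₁₃ ≤ b(s + 1) + Z + 1 and f₁₂₃ ≥ bts + XZ.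
-- Multiplying by t clears the denominator of v(Δ,t) = bf₂₃ + X(f₁₃ − bf₂₃/t),
-- and t·f₁₂₃ − t·(v(Δ,t) − f₁₂) is then at least b(t − X)(t − y) ≥ 0.
module Submission where

open import Defs
open import Data.Nat using (_≤_)
open import Data.Product using (_×_; ∃-syntax)
open import Relation.Binary.PropositionalEquality using (_≡_)
open import Data.Rational as ℚ using ()

open import Data.Nat
open import Data.Nat.Properties
open import Data.Nat.Tactic.RingSolver using (solve)
open import Data.List using (_∷_; [])
open import Data.Bool using (Bool; true; false; T; _∧_)
open import Data.Bool.Properties using (T-∧; T-∨)
open import Data.Fin using (toℕ; zero; suc)
open import Data.Product using (_,_)
open import Data.Sum using (_⊎_; inj₁; inj₂)
open import Data.Empty using (⊥-elim)
open import Function.Bundles using (Equivalence)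
import Data.Integer as ℤ
import Data.Integer.Properties as ℤ
import Data.Integer.Tactic.RingSolver as ℤ-Solver
import Data.Rational.Properties as ℚ
open import Data.Rational.Unnormalised as ℚᵘ using (ℚᵘ; mkℚᵘ; *≡*; *≤*)
import Data.Rational.Unnormalised.Properties as ℚᵘ
open import Data.Rational.Solver using (module +-*-Solver)
open import Relation.Binary.PropositionalEquality
  using (_≢_; refl; sym; trans; cong; cong₂; subst; subst₂; module ≡-Reasoning)

sumTo : ℕ → (ℕ → ℕ) → ℕ
sumTo zero    f = 0
sumTo (suc n) f = f 0 + sumTo n (λ i → f (suc i))

sumTo-cong : ∀ n {f g : ℕ → ℕ} → (∀ i → i < n → f i ≡ g i) → sumTo n f ≡ sumTo n g
sumTo-cong zero    _  = refl
sumTo-cong (suc n) eq = cong₂ _+_ (eq 0 z<s) (sumTo-cong n (λ i i<n → eq (suc i) (s<s i<n)))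

sumFin-toℕ : ∀ n (f : ℕ → ℕ) → sumFin n (λ i → f (toℕ i)) ≡ sumTo n f
sumFin-toℕ zero    f = refl
sumFin-toℕ (suc n) f = cong (f 0 +_) (sumFin-toℕ n (λ i → f (suc i)))

sumFin-toℕ² : ∀ m n (h : ℕ → ℕ → ℕ) →
  sumFin m (λ i → sumFin n (λ j → h (toℕ i) (toℕ j))) ≡ sumTo m (λ x → sumTo n (h x))
sumFin-toℕ² m n h = trans (sumFin-toℕ m _) (sumTo-cong m (λ x _ → sumFin-toℕ n (h x)))

sumFin-toℕ³ : ∀ m n o (h : ℕ → ℕ → ℕ → ℕ) →
  sumFin m (λ i → sumFin n (λ j → sumFin o (λ k → h (toℕ i) (toℕ j) (toℕ k))))
  ≡ sumTo m (λ x → sumTo n (λ y → sumTo o (h x y)))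
sumFin-toℕ³ m n o h = trans (sumFin-toℕ m _) (sumTo-cong m (λ x _ → sumFin-toℕ² n o (h x)))

sumTo-mono-≤ : ∀ n {f g : ℕ → ℕ} → (∀ i → i < n → f i ≤ g i) → sumTo n f ≤ sumTo n g
sumTo-mono-≤ zero    _  = z≤n
sumTo-mono-≤ (suc n) le = +-mono-≤ (le 0 z<s) (sumTo-mono-≤ n (λ i i<n → le (suc i) (s<s i<n)))

sumTo-const : ∀ n c → sumTo n (λ _ → c) ≡ n * c
sumTo-const zero    c = refl
sumTo-const (suc n) c = cong (c +_) (sumTo-const n c)

sumTo-block : ∀ n {f : ℕ → ℕ} {c} → (∀ i → i < n → f i ≡ c) → sumTo n f ≡ n * c
sumTo-block n {c = c} eq = trans (sumTo-cong n eq) (sumTo-const n c)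

sumTo-suc : ∀ n f → sumTo (suc n) f ≡ sumTo n f + f n
sumTo-suc zero    f = +-comm (f 0) 0
sumTo-suc (suc n) f = trans (cong (f 0 +_) (sumTo-suc n (λ i → f (suc i))))
                            (sym (+-assoc (f 0) _ _))

sumTo-mono-length : ∀ {m n} f → m ≤ n → sumTo m f ≤ sumTo n f
sumTo-mono-length f z≤n       = z≤n
sumTo-mono-length f (s≤s m≤n) = +-monoʳ-≤ (f 0) (sumTo-mono-length (λ i → f (suc i)) m≤n)

sumTo-*ˡ : ∀ n c f → sumTo n (λ i → c * f i) ≡ c * sumTo n f
sumTo-*ˡ zero    c f = sym (*-zeroʳ c)
sumTo-*ˡ (suc n) c f = trans (cong (c * f 0 +_) (sumTo-*ˡ n c (λ i → f (suc i))))
                             (sym (*-distribˡ-+ c (f 0) _))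

sumTo-*ʳ : ∀ n c f → sumTo n (λ i → f i * c) ≡ sumTo n f * c
sumTo-*ʳ zero    c f = refl
sumTo-*ʳ (suc n) c f = trans (cong (f 0 * c +_) (sumTo-*ʳ n c (λ i → f (suc i))))
                             (sym (*-distribʳ-+ c (f 0) _))

sumTo-product : ∀ m n f g → sumTo m (λ i → sumTo n (λ j → f i * g j)) ≡ sumTo m f * sumTo n g
sumTo-product m n f g = trans (sumTo-cong m (λ i _ → sumTo-*ˡ n (f i) g)) (sumTo-*ʳ m (sumTo n g) f)

b2n≤1 : ∀ β → b2n β ≤ 1
b2n≤1 true  = s≤s z≤n
b2n≤1 false = z≤n

b2n-T : ∀ {β} → T β → b2n β ≡ 1
b2n-T {true} _ = refl

b2n-∧-∧T : ∀ α β {γ} → T γ → b2n (α ∧ β ∧ γ) ≡ b2n α * b2n β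
b2n-∧-∧T true  true  {true} _ = refl
b2n-∧-∧T true  false        _ = refl
b2n-∧-∧T false β            _ = refl

count-≤ : ∀ n (f : ℕ → Bool) → sumTo n (λ i → b2n (f i)) ≤ n
count-≤ n f = ≤-trans (sumTo-mono-≤ n (λ i _ → b2n≤1 (f i)))
                      (≤-reflexive (trans (sumTo-const n 1) (*-identityʳ n)))

count-full : ∀ n {f : ℕ → Bool} → (∀ i → i < n → T (f i)) → sumTo n (λ i → b2n (f i)) ≡ n
count-full n full = trans (sumTo-block n (λ i i<n → b2n-T (full i i<n))) (*-identityʳ n)

+-≤-≡⇒≡ : ∀ {a b a′ b′} → a ≤ a′ → b ≤ b′ → a + b ≡ a′ + b′ → a ≡ a′ × b ≡ b′
+-≤-≡⇒≡ {a} {b} {a′} {b′} a≤a′ b≤b′ eq =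
  ≤-antisym a≤a′ (+-cancelʳ-≤ b′ a′ a (subst (_≤ a + b′) eq (+-monoʳ-≤ a b≤b′))) ,
  ≤-antisym b≤b′ (+-cancelˡ-≤ a′ b′ b (subst (_≤ a′ + b) eq (+-monoˡ-≤ b a≤a′)))

x≤t⇒y≤t⇒t*y+t*x≤t*t+x*y : ∀ {t x y} → x ≤ t → y ≤ t → t * y + t * x ≤ t * t + x * y
x≤t⇒y≤t⇒t*y+t*x≤t*t+x*y {t} {x} {y} x≤t y≤t with m≤n⇒∃[o]m+o≡n x≤t
... | a , refl = begin
  (x + a) * y + (x + a) * x          ≡⟨ solve (x ∷ a ∷ y ∷ []) ⟩
  x * y + (x + a) * x + a * y        ≤⟨ +-monoʳ-≤ (x * y + (x + a) * x) (*-monoʳ-≤ a y≤t) ⟩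
  x * y + (x + a) * x + a * (x + a)  ≡⟨ solve (x ∷ a ∷ y ∷ []) ⟩
  (x + a) * (x + a) + x * y          ∎
  where open ≤-Reasoning

AtMostOneMore : ℕ → ℕ → Set
AtMostOneMore m n = m ≡ n ⊎ m ≡ suc n

AtMostOneMore⇒≥ : ∀ {m n} → AtMostOneMore m n → n ≤ m
AtMostOneMore⇒≥ (inj₁ refl) = ≤-refl
AtMostOneMore⇒≥ (inj₂ refl) = n≤1+n _

AtMostOneMore⇒≤suc : ∀ {m n} → AtMostOneMore m n → m ≤ suc n
AtMostOneMore⇒≤suc (inj₁ refl) = n≤1+n _
AtMostOneMore⇒≤suc (inj₂ refl) = ≤-refl

+b2n+0 : ∀ n β → AtMostOneMore (n + b2n β + 0) n
+b2n+0 n false = inj₁ (trans (+-identityʳ _) (+-identityʳ n))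
+b2n+0 n true  = inj₂ (trans (+-identityʳ _) (+-comm n 1))

+0+b2n : ∀ n β → AtMostOneMore (n + 0 + b2n β) n
+0+b2n n false = inj₁ (trans (+-identityʳ _) (+-identityʳ n))
+0+b2n n true  = inj₂ (trans (cong (_+ 1) (+-identityʳ n)) (+-comm n 1))

edgeCount : (ℕ → ℕ → Bool) → ℕ → ℕ → ℕ
edgeCount E m n = sumTo m λ x → sumTo n λ y → b2n (E x y)

triangleCount : (E₁₂ E₁₃ E₂₃ : ℕ → ℕ → Bool) → ℕ → ℕ → ℕ → ℕ
triangleCount E₁₂ E₁₃ E₂₃ n₁ n₂ n₃ =
  sumTo n₁ λ x → sumTo n₂ λ y → sumTo n₃ λ z → b2n (E₁₂ x y ∧ E₁₃ x z ∧ E₂₃ y z)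

-- The counts of a complete b × t × s block enlarged by at most one vertex of
-- colour 1 (with X neighbours of colour 2 and Z among the first s of colour 3)
-- and at most one vertex of colour 3.
record BlockCounts (b t s F₁₂ F₁₃ F₂₃ F₁₂₃ : ℕ) : Set where
  constructor mkBlockCounts
  field
    X Z     : ℕ
    X≤t     : X ≤ t
    F₁₂≡    : F₁₂ ≡ b * t + X
    ts≤F₂₃  : t * s ≤ F₂₃
    F₂₃≤    : F₂₃ ≤ t * suc s
    F₁₃≤    : F₁₃ ≤ b * (s + 1) + (Z + 1)
    F₁₂₃≥   : b * (t * s) + X * Z ≤ F₁₂₃

module CompleteBlock {b t s : ℕ} (E₁₂ E₁₃ E₂₃ : ℕ → ℕ → Bool)
  (full₁₂ : ∀ x y → x < b → y < t → T (E₁₂ x y))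
  (full₁₃ : ∀ x z → x < b → z < s → T (E₁₃ x z))
  (full₂₃ : ∀ y z → y < t → z < s → T (E₂₃ y z)) where

  deg₁₂ deg₁₃ : ℕ → ℕ
  deg₁₂ x = sumTo t λ y → b2n (E₁₂ x y)
  deg₁₃ x = sumTo s λ z → b2n (E₁₃ x z)

  edges₁₃-≤ : ∀ n₁ {n₃} → n₃ ≤ suc s → edgeCount E₁₃ n₁ n₃ ≤ sumTo n₁ (λ x → deg₁₃ x + 1)
  edges₁₃-≤ n₁ {n₃} n₃≤ = sumTo-mono-≤ n₁ λ x _ → begin
    sumTo n₃ (λ z → b2n (E₁₃ x z))       ≤⟨ sumTo-mono-length _ n₃≤ ⟩
    sumTo (suc s) (λ z → b2n (E₁₃ x z))  ≡⟨ sumTo-suc s _ ⟩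
    deg₁₃ x + b2n (E₁₃ x s)              ≤⟨ +-monoʳ-≤ (deg₁₃ x) (b2n≤1 _) ⟩
    deg₁₃ x + 1                          ∎
    where open ≤-Reasoning

  edges₂₃-≥ : ∀ {n₃} → s ≤ n₃ → t * s ≤ edgeCount E₂₃ t n₃
  edges₂₃-≥ {n₃} s≤n₃ = begin
    t * s                                              ≡⟨ sumTo-block t (λ y y<t → count-full s (λ z z<s′ → full₂₃ y z y<t z<s′)) ⟨
    sumTo t (λ y → sumTo s (λ z → b2n (E₂₃ y z)))      ≤⟨ sumTo-mono-≤ t (λ y _ → sumTo-mono-length _ s≤n₃) ⟩
    edgeCount E₂₃ t n₃                                 ∎
    where open ≤-Reasoning

  edges₂₃-≤ : ∀ {n₃} → n₃ ≤ suc s → edgeCount E₂₃ t n₃ ≤ t * suc s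
  edges₂₃-≤ n₃≤ = ≤-trans (sumTo-mono-≤ t (λ y _ → ≤-trans (count-≤ _ _) n₃≤))
                          (≤-reflexive (sumTo-const t (suc s)))

  -- Every pair of a colour-2 and a colour-3 neighbour inside the block spans a facet with x.
  triangles-row-≥ : ∀ x {n₃} → s ≤ n₃ →
    deg₁₂ x * deg₁₃ x ≤ sumTo t (λ y → sumTo n₃ (λ z → b2n (E₁₂ x y ∧ E₁₃ x z ∧ E₂₃ y z)))
  triangles-row-≥ x {n₃} s≤n₃ = begin
    deg₁₂ x * deg₁₃ x
      ≡⟨ sumTo-product t s _ _ ⟨
    sumTo t (λ y → sumTo s (λ z → b2n (E₁₂ x y) * b2n (E₁₃ x z)))
      ≡⟨ sumTo-cong t (λ y y<t → sumTo-cong s (λ z z<s′ → facet y z y<t z<s′)) ⟩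
    sumTo t (λ y → sumTo s (λ z → b2n (E₁₂ x y ∧ E₁₃ x z ∧ E₂₃ y z)))
      ≤⟨ sumTo-mono-≤ t (λ y _ → sumTo-mono-length _ s≤n₃) ⟩
    sumTo t (λ y → sumTo n₃ (λ z → b2n (E₁₂ x y ∧ E₁₃ x z ∧ E₂₃ y z)))  ∎
    where
    open ≤-Reasoning
    facet : ∀ y z → y < t → z < s →
      b2n (E₁₂ x y) * b2n (E₁₃ x z) ≡ b2n (E₁₂ x y ∧ E₁₃ x z ∧ E₂₃ y z)
    facet y z y<t z<s′ = sym (b2n-∧-∧T (E₁₂ x y) (E₁₃ x z) (full₂₃ y z y<t z<s′))

  triangles-≥ : ∀ n₁ {n₃} → s ≤ n₃ →
    sumTo n₁ (λ x → deg₁₂ x * deg₁₃ x) ≤ triangleCount E₁₂ E₁₃ E₂₃ n₁ t n₃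
  triangles-≥ n₁ s≤n₃ = sumTo-mono-≤ n₁ (λ x _ → triangles-row-≥ x s≤n₃)

  rows₁₂ : sumTo b deg₁₂ ≡ b * t
  rows₁₂ = sumTo-block b (λ x x<b → count-full t (λ y y<t → full₁₂ x y x<b y<t))

  rows₁₃ : sumTo b (λ x → deg₁₃ x + 1) ≡ b * (s + 1)
  rows₁₃ = sumTo-block b (λ x x<b → cong (_+ 1) (count-full s (λ z z<s′ → full₁₃ x z x<b z<s′)))

  rows₁₂₃ : sumTo b (λ x → deg₁₂ x * deg₁₃ x) ≡ b * (t * s)
  rows₁₂₃ = sumTo-block b (λ x x<b → cong₂ _*_
    (count-full t (λ y y<t → full₁₂ x y x<b y<t)) (count-full s (λ z z<s′ → full₁₃ x z x<b z<s′)))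

  counts : ∀ {n₁ n₂ n₃} → AtMostOneMore n₁ b → n₂ ≡ t → s ≤ n₃ → n₃ ≤ suc s →
    BlockCounts b t s (edgeCount E₁₂ n₁ n₂) (edgeCount E₁₃ n₁ n₃) (edgeCount E₂₃ n₂ n₃)
                      (triangleCount E₁₂ E₁₃ E₂₃ n₁ n₂ n₃)
  counts (inj₁ refl) refl s≤n₃ n₃≤ = mkBlockCounts 0 0 z≤n
    (trans rows₁₂ (sym (+-identityʳ _)))
    (edges₂₃-≥ s≤n₃) (edges₂₃-≤ n₃≤)
    (≤-trans (edges₁₃-≤ b n₃≤) (≤-trans (≤-reflexive rows₁₃) (m≤m+n _ _)))
    (≤-trans (≤-reflexive (trans (+-identityʳ _) (sym rows₁₂₃))) (triangles-≥ b s≤n₃))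
  counts {n₃ = n₃} (inj₂ refl) refl s≤n₃ n₃≤ = mkBlockCounts (deg₁₂ b) (deg₁₃ b) (count-≤ t _)
    (trans (sumTo-suc b deg₁₂) (cong (_+ deg₁₂ b) rows₁₂))
    (edges₂₃-≥ s≤n₃) (edges₂₃-≤ n₃≤)
    (begin
      edgeCount E₁₃ (suc b) n₃                              ≤⟨ edges₁₃-≤ (suc b) n₃≤ ⟩
      sumTo (suc b) (λ x → deg₁₃ x + 1)                     ≡⟨ sumTo-suc b _ ⟩
      sumTo b (λ x → deg₁₃ x + 1) + (deg₁₃ b + 1)           ≡⟨ cong (_+ (deg₁₃ b + 1)) rows₁₃ ⟩
      b * (s + 1) + (deg₁₃ b + 1)                           ∎)
    (begin
      b * (t * s) + deg₁₂ b * deg₁₃ b                       ≡⟨ cong (_+ deg₁₂ b * deg₁₃ b) rows₁₂₃ ⟨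
      sumTo b (λ x → deg₁₂ x * deg₁₃ x) + deg₁₂ b * deg₁₃ b ≡⟨ sumTo-suc b _ ⟨
      sumTo (suc b) (λ x → deg₁₂ x * deg₁₃ x)               ≤⟨ triangles-≥ (suc b) s≤n₃ ⟩
      triangleCount E₁₂ E₁₃ E₂₃ (suc b) t n₃                ∎)
    where open ≤-Reasoning

BlockCounts-resp : ∀ {b t s F₁₂ F₁₃ F₂₃ F₁₂₃ F₁₂′ F₁₃′ F₂₃′ F₁₂₃′} →
  F₁₂ ≡ F₁₂′ → F₁₃ ≡ F₁₃′ → F₂₃ ≡ F₂₃′ → F₁₂₃ ≡ F₁₂₃′ →
  BlockCounts b t s F₁₂ F₁₃ F₂₃ F₁₂₃ → BlockCounts b t s F₁₂′ F₁₃′ F₂₃′ F₁₂₃′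
BlockCounts-resp refl refl refl refl B = B

-- The two sides differ by at least b (t − X)(t − y), where F₂₃ = t s + y.
facet-bound : ∀ {b t s F₁₂ F₁₃ F₂₃ F₁₂₃} (B : BlockCounts b t s F₁₂ F₁₃ F₂₃ F₁₂₃) →
  let X = BlockCounts.X B in
  t * (b * F₂₃) + t * X * F₁₃ ≤ t * F₁₂ + X * (b * F₂₃) + t * F₁₂₃
facet-bound {b} {t} {s} {F₁₃ = F₁₃} {F₁₂₃ = F₁₂₃} (mkBlockCounts X Z X≤t refl ts≤F₂₃ F₂₃≤ F₁₃≤ F₁₂₃≥)
  with m≤n⇒∃[o]m+o≡n ts≤F₂₃
... | y , refl = begin
  t * (b * (t * s + y)) + t * X * F₁₃
    ≤⟨ +-monoʳ-≤ (t * (b * (t * s + y))) (*-monoʳ-≤ (t * X) F₁₃≤) ⟩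
  t * (b * (t * s + y)) + t * X * (b * (s + 1) + (Z + 1))
    ≡⟨ solve (b ∷ t ∷ s ∷ X ∷ Z ∷ y ∷ []) ⟩
  (b * t * t * s + t * X * b * s + t * X * Z + t * X) + b * (t * y + t * X)
    ≤⟨ +-monoʳ-≤ (b * t * t * s + t * X * b * s + t * X * Z + t * X)
                 (*-monoʳ-≤ b (x≤t⇒y≤t⇒t*y+t*x≤t*t+x*y X≤t y≤t)) ⟩
  (b * t * t * s + t * X * b * s + t * X * Z + t * X) + b * (t * t + X * y)
    ≡⟨ solve (b ∷ t ∷ s ∷ X ∷ Z ∷ y ∷ []) ⟩
  t * (b * t + X) + X * (b * (t * s + y)) + t * (b * (t * s) + X * Z)
    ≤⟨ +-monoʳ-≤ (t * (b * t + X) + X * (b * (t * s + y))) (*-monoʳ-≤ t F₁₂₃≥) ⟩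
  t * (b * t + X) + X * (b * (t * s + y)) + t * F₁₂₃  ∎
  where
  open ≤-Reasoning
  y≤t : y ≤ t
  y≤t = +-cancelˡ-≤ (t * s) y t (subst (t * s + y ≤_) (trans (*-suc t s) (+-comm t (t * s))) F₂₃≤)

ℕ→ℚᵘ : ℕ → ℚᵘ
ℕ→ℚᵘ n = mkℚᵘ (ℤ.+ n) 0

toℚᵘ-ℕ→ℚ : ∀ n → ℚ.toℚᵘ (ℕ→ℚ n) ℚᵘ.≃ ℕ→ℚᵘ n
toℚᵘ-ℕ→ℚ n = ℚ.toℚᵘ-fromℚᵘ (ℕ→ℚᵘ n)

ℕ→ℚᵘ-+ : ∀ m n → ℕ→ℚᵘ (m + n) ℚᵘ.≃ ℕ→ℚᵘ m ℚᵘ.+ ℕ→ℚᵘ n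
ℕ→ℚᵘ-+ m n = *≡* (trans (cong (ℤ._* ℤ.1ℤ) (ℤ.pos-+ m n)) (distrib (ℤ.+ m) (ℤ.+ n)))
  where
  distrib : ∀ a b → (a ℤ.+ b) ℤ.* ℤ.1ℤ ≡ (a ℤ.* ℤ.1ℤ ℤ.+ b ℤ.* ℤ.1ℤ) ℤ.* ℤ.1ℤ
  distrib = ℤ-Solver.solve-∀

ℕ→ℚᵘ-* : ∀ m n → ℕ→ℚᵘ (m * n) ℚᵘ.≃ ℕ→ℚᵘ m ℚᵘ.* ℕ→ℚᵘ n
ℕ→ℚᵘ-* m n = *≡* (cong (ℤ._* ℤ.1ℤ) (ℤ.pos-* m n))

ℕ→ℚ-+ : ∀ m n → ℕ→ℚ (m + n) ≡ ℕ→ℚ m ℚ.+ ℕ→ℚ n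
ℕ→ℚ-+ m n = ℚ.toℚᵘ-injective (begin
  ℚ.toℚᵘ (ℕ→ℚ (m + n))                         ≈⟨ toℚᵘ-ℕ→ℚ (m + n) ⟩
  ℕ→ℚᵘ (m + n)                                  ≈⟨ ℕ→ℚᵘ-+ m n ⟩
  ℕ→ℚᵘ m ℚᵘ.+ ℕ→ℚᵘ n                            ≈⟨ ℚᵘ.+-cong (toℚᵘ-ℕ→ℚ m) (toℚᵘ-ℕ→ℚ n) ⟨
  ℚ.toℚᵘ (ℕ→ℚ m) ℚᵘ.+ ℚ.toℚᵘ (ℕ→ℚ n)            ≈⟨ ℚ.toℚᵘ-homo-+ (ℕ→ℚ m) (ℕ→ℚ n) ⟨
  ℚ.toℚᵘ (ℕ→ℚ m ℚ.+ ℕ→ℚ n)                      ∎)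
  where open ℚᵘ.≃-Reasoning

ℕ→ℚ-* : ∀ m n → ℕ→ℚ (m * n) ≡ ℕ→ℚ m ℚ.* ℕ→ℚ n
ℕ→ℚ-* m n = ℚ.toℚᵘ-injective (begin
  ℚ.toℚᵘ (ℕ→ℚ (m * n))                         ≈⟨ toℚᵘ-ℕ→ℚ (m * n) ⟩
  ℕ→ℚᵘ (m * n)                                  ≈⟨ ℕ→ℚᵘ-* m n ⟩
  ℕ→ℚᵘ m ℚᵘ.* ℕ→ℚᵘ n                            ≈⟨ ℚᵘ.*-cong (toℚᵘ-ℕ→ℚ m) (toℚᵘ-ℕ→ℚ n) ⟨
  ℚ.toℚᵘ (ℕ→ℚ m) ℚᵘ.* ℚ.toℚᵘ (ℕ→ℚ n)            ≈⟨ ℚ.toℚᵘ-homo-* (ℕ→ℚ m) (ℕ→ℚ n) ⟨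
  ℚ.toℚᵘ (ℕ→ℚ m ℚ.* ℕ→ℚ n)                      ∎)
  where open ℚᵘ.≃-Reasoning

ℕ→ℚ-mono-≤ : ∀ {m n} → m ≤ n → ℕ→ℚ m ℚ.≤ ℕ→ℚ n
ℕ→ℚ-mono-≤ {m} {n} m≤n = ℚ.toℚᵘ-cancel-≤
  (ℚᵘ.≤-respʳ-≃ (ℚᵘ.≃-sym (toℚᵘ-ℕ→ℚ n)) (ℚᵘ.≤-respˡ-≃ (ℚᵘ.≃-sym (toℚᵘ-ℕ→ℚ m))
    (*≤* (subst₂ ℤ._≤_ (sym (ℤ.*-identityʳ _)) (sym (ℤ.*-identityʳ _)) (ℤ.+≤+ m≤n)))))

/-*-cancel : ∀ k t → (ℤ.+ k ℚ./ suc t) ℚ.* ℕ→ℚ (suc t) ≡ ℕ→ℚ k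
/-*-cancel k t = ℚ.toℚᵘ-injective (begin
  ℚ.toℚᵘ ((ℤ.+ k ℚ./ suc t) ℚ.* ℕ→ℚ (suc t))            ≈⟨ ℚ.toℚᵘ-homo-* (ℤ.+ k ℚ./ suc t) (ℕ→ℚ (suc t)) ⟩
  ℚ.toℚᵘ (ℤ.+ k ℚ./ suc t) ℚᵘ.* ℚ.toℚᵘ (ℕ→ℚ (suc t))    ≈⟨ ℚᵘ.*-cong (ℚ.toℚᵘ-fromℚᵘ (mkℚᵘ (ℤ.+ k) t)) (toℚᵘ-ℕ→ℚ (suc t)) ⟩
  mkℚᵘ (ℤ.+ k) t ℚᵘ.* ℕ→ℚᵘ (suc t)                        ≈⟨ *≡* cancel ⟩
  ℕ→ℚᵘ k                                                  ≈⟨ toℚᵘ-ℕ→ℚ k ⟨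
  ℚ.toℚᵘ (ℕ→ℚ k)                                          ∎)
  where
  open ℚᵘ.≃-Reasoning
  cancel : (ℤ.+ k ℤ.* ℤ.+ suc t) ℤ.* ℤ.1ℤ ≡ ℤ.+ k ℤ.* ℤ.+ (suc t * 1)
  cancel = trans (ℤ.*-identityʳ _) (cong (λ d → ℤ.+ k ℤ.* ℤ.+ d) (sym (*-identityʳ (suc t))))

scaled-bound : ∀ τ .{{_ : ℚ.Positive τ}} κ C x a f T → κ ℚ.* τ ≡ C →
  τ ℚ.* C ℚ.+ τ ℚ.* x ℚ.* a ℚ.≤ τ ℚ.* f ℚ.+ x ℚ.* C ℚ.+ τ ℚ.* T →
  C ℚ.+ x ℚ.* (a ℚ.- κ) ℚ.- f ℚ.≤ T
scaled-bound τ κ _ x a f T refl le = ℚ.*-cancelˡ-≤-pos τ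
  (subst₂ ℚ._≤_ (lhs τ κ x a f) (rhs τ κ x f T) (ℚ.+-monoˡ-≤ (ℚ.- (τ ℚ.* f ℚ.+ x ℚ.* (κ ℚ.* τ))) le))
  where
  open +-*-Solver hiding (solve)
  lhs : ∀ τ κ x a f → τ ℚ.* (κ ℚ.* τ) ℚ.+ τ ℚ.* x ℚ.* a ℚ.- (τ ℚ.* f ℚ.+ x ℚ.* (κ ℚ.* τ))
                      ≡ τ ℚ.* (κ ℚ.* τ ℚ.+ x ℚ.* (a ℚ.- κ) ℚ.- f)
  lhs = +-*-Solver.solve 5 (λ τ κ x a f → τ :* (κ :* τ) :+ τ :* x :* a :- (τ :* f :+ x :* (κ :* τ))
                             := τ :* (κ :* τ :+ x :* (a :- κ) :- f)) refl
  rhs : ∀ τ κ x f T → τ ℚ.* f ℚ.+ x ℚ.* (κ ℚ.* τ) ℚ.+ τ ℚ.* T ℚ.- (τ ℚ.* f ℚ.+ x ℚ.* (κ ℚ.* τ))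
                      ≡ τ ℚ.* T
  rhs = +-*-Solver.solve 5 (λ τ κ x f T → τ :* f :+ x :* (κ :* τ) :+ τ :* T :- (τ :* f :+ x :* (κ :* τ))
                             := τ :* T) refl

v-bound : ∀ Δ {t s T} → 0 < t → BlockCounts (b1 Δ) t s (f12 Δ) (f13 Δ) (f23 Δ) T →
  v Δ t ℚ.- ℕ→ℚ (f12 Δ) ℚ.≤ ℕ→ℚ T
v-bound Δ {suc t} {T = T} _ B =
  subst (λ y → C ℚ.+ y ℚ.* (φ₁₃ ℚ.- C/τ) ℚ.- φ₁₂ ℚ.≤ ℕ→ℚ T) (sym excess)
    (scaled-bound τ C/τ C x φ₁₃ φ₁₂ (ℕ→ℚ T) (/-*-cancel (b * f23 Δ) t)
      (subst₂ ℚ._≤_ lhs rhs (ℕ→ℚ-mono-≤ (facet-bound B))))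
  where
  open ≡-Reasoning
  b X : ℕ
  b = b1 Δ
  X = BlockCounts.X B
  τ C C/τ x φ₁₂ φ₁₃ : ℚ.ℚ
  τ = ℕ→ℚ (suc t)
  C = ℕ→ℚ (b * f23 Δ)
  C/τ = ℤ.+ (b * f23 Δ) ℚ./ suc t
  x = ℕ→ℚ X
  φ₁₂ = ℕ→ℚ (f12 Δ)
  φ₁₃ = ℕ→ℚ (f13 Δ)

  instance
    τ-positive : ℚ.Positive τ
    τ-positive = ℚ.normalize-pos (suc t) 1

  excess : φ₁₂ ℚ.- ℕ→ℚ (b * suc t) ≡ x
  excess = begin
    φ₁₂ ℚ.- ℕ→ℚ (b * suc t)                       ≡⟨ cong (λ n → ℕ→ℚ n ℚ.- ℕ→ℚ (b * suc t)) (BlockCounts.F₁₂≡ B) ⟩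
    ℕ→ℚ (b * suc t + X) ℚ.- ℕ→ℚ (b * suc t)       ≡⟨ cong (ℚ._- ℕ→ℚ (b * suc t)) (ℕ→ℚ-+ (b * suc t) X) ⟩
    ℕ→ℚ (b * suc t) ℚ.+ x ℚ.- ℕ→ℚ (b * suc t)     ≡⟨ +-*-Solver.solve 2 (λ m y → m :+ y :- m := y) refl (ℕ→ℚ (b * suc t)) x ⟩
    x                                              ∎
    where open +-*-Solver hiding (solve)

  lhs : ℕ→ℚ (suc t * (b * f23 Δ) + suc t * X * f13 Δ) ≡ τ ℚ.* C ℚ.+ τ ℚ.* x ℚ.* φ₁₃
  lhs = trans (ℕ→ℚ-+ (suc t * (b * f23 Δ)) (suc t * X * f13 Δ))
              (cong₂ ℚ._+_ (ℕ→ℚ-* (suc t) (b * f23 Δ))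
                           (trans (ℕ→ℚ-* (suc t * X) (f13 Δ)) (cong (ℚ._* φ₁₃) (ℕ→ℚ-* (suc t) X))))

  rhs : ℕ→ℚ (suc t * f12 Δ + X * (b * f23 Δ) + suc t * T) ≡ τ ℚ.* φ₁₂ ℚ.+ x ℚ.* C ℚ.+ τ ℚ.* ℕ→ℚ T
  rhs = trans (ℕ→ℚ-+ (suc t * f12 Δ + X * (b * f23 Δ)) (suc t * T))
              (cong₂ ℚ._+_ (trans (ℕ→ℚ-+ (suc t * f12 Δ) (X * (b * f23 Δ)))
                                  (cong₂ ℚ._+_ (ℕ→ℚ-* (suc t) (f12 Δ)) (ℕ→ℚ-* X (b * f23 Δ))))
                           (ℕ→ℚ-* (suc t) T))

module _ (Δ : Complex3) (P : Params) where
  open Construction Δ P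

  adj-block : ∀ a c {x y} → x < g P a → y < g P c → T (adj a c x y)
  adj-block a c x<g y<g = Equivalence.from T-∨ (inj₁ (Equivalence.from T-∧ (<⇒<ᵇ x<g , <⇒<ᵇ y<g)))

  VertexShape : Set
  VertexShape = AtMostOneMore (nv zero) (g1 P) × nv (suc zero) ≡ g2 P
              × AtMostOneMore (nv (suc (suc zero))) (g3 P)

  E₁₂ E₁₃ E₂₃ : ℕ → ℕ → Bool
  E₁₂ = adj zero (suc zero)
  E₁₃ = adj zero (suc (suc zero))
  E₂₃ = adj (suc zero) (suc (suc zero))

  Γ-blockCounts : VertexShape → BlockCounts (g1 P) (g2 P) (g3 P) (f12 Γ) (f13 Γ) (f23 Γ) (f123 Γ)
  Γ-blockCounts (n₁ , n₂ , n₃) = BlockCounts-resp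
    (sym (sumFin-toℕ² (nv zero) (nv (suc zero)) (λ x y → b2n (E₁₂ x y))))
    (sym (sumFin-toℕ² (nv zero) (nv (suc (suc zero))) (λ x z → b2n (E₁₃ x z))))
    (sym (sumFin-toℕ² (nv (suc zero)) (nv (suc (suc zero))) (λ y z → b2n (E₂₃ y z))))
    (sym (sumFin-toℕ³ (nv zero) (nv (suc zero)) (nv (suc (suc zero)))
                      (λ x y z → b2n (E₁₂ x y ∧ E₁₃ x z ∧ E₂₃ y z))))
    (CompleteBlock.counts E₁₂ E₁₃ E₂₃
      (λ _ _ → adj-block zero (suc zero)) (λ _ _ → adj-block zero (suc (suc zero)))
      (λ _ _ → adj-block (suc zero) (suc (suc zero)))
      n₁ n₂ (AtMostOneMore⇒≥ n₃) (AtMostOneMore⇒≤suc n₃))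

-- r = 2 forces {p, q} = {1, 3}, except for p = q = 2, which p ≢ q rules out.
vertexShape : ∀ Δ P → p P ≢ q P → r P ≡ 2 → VertexShape Δ P
vertexShape Δ P@(params g zero (suc (suc zero))) _ _ =
  +b2n+0 (g zero) (Construction.addP Δ P) , trans (+-identityʳ _) (+-identityʳ _) ,
  +0+b2n (g (suc (suc zero))) (Construction.addQ Δ P)
vertexShape Δ P@(params g (suc (suc zero)) zero) _ _ =
  +0+b2n (g zero) (Construction.addQ Δ P) , trans (+-identityʳ _) (+-identityʳ _) ,
  +b2n+0 (g (suc (suc zero))) (Construction.addP Δ P)
vertexShape Δ (params g (suc zero) (suc zero)) p≢q _ = ⊥-elim (p≢q refl)
vertexShape Δ (params g zero zero) _ ()
vertexShape Δ (params g zero (suc zero)) _ ()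
vertexShape Δ (params g (suc zero) zero) _ ()
vertexShape Δ (params g (suc zero) (suc (suc zero))) _ ()
vertexShape Δ (params g (suc (suc zero)) (suc zero)) _ ()
vertexShape Δ (params g (suc (suc zero)) (suc (suc zero))) _ ()

facetCounts : ∀ Δ P → InF Δ P → r P ≡ 2 →
  BlockCounts (g1 P) (g2 P) (g3 P) (f12 Δ) (f13 Δ) (f23 Δ) (f123 Γ[ Δ , P ])
facetCounts Δ P ((_ , p≢q , _ , (_ , _ , _ , ≤f₁₂ , ≤f₁₃ , ≤f₂₃)) , esum≡ , _) r≡2 =
  let f₁₂+f₁₃≡ , f₂₃≡ = +-≤-≡⇒≡ (+-mono-≤ ≤f₁₂ ≤f₁₃) ≤f₂₃ esum≡
      f₁₂≡ , f₁₃≡     = +-≤-≡⇒≡ ≤f₁₂ ≤f₁₃ f₁₂+f₁₃≡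
  in BlockCounts-resp f₁₂≡ f₁₃≡ f₂₃≡ refl (Γ-blockCounts Δ P (vertexShape Δ P p≢q r≡2))

lemma2p20 : (Δ : Complex3) → Positive Δ →
    f12 Δ ≤ f13 Δ → f12 Δ ≤ f23 Δ →
    (Γ₀ : Params) → InF Δ Γ₀ → g1 Γ₀ ≡ b1 Δ → r Γ₀ ≡ 2 →
    ∃[ Γ ] (InF Δ Γ × (v Δ (g2 Γ₀) ℚ.- ℕ→ℚ (f12 Δ)) ℚ.≤ ℕ→ℚ (f123 Γ[ Δ , Γ ]))
lemma2p20 Δ _ _ _ Γ₀ Γ₀∈F@(((_ , 0<g₂ , _) , _) , _) g₁≡b₁ r≡2 = Γ₀ , Γ₀∈F , v-bound Δ 0<g₂ counts
  where
  counts : BlockCounts (b1 Δ) (g2 Γ₀) (g3 Γ₀) (f12 Δ) (f13 Δ) (f23 Δ) (f123 Γ[ Δ , Γ₀ ])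
  counts = subst (λ b → BlockCounts b (g2 Γ₀) (g3 Γ₀) (f12 Δ) (f13 Δ) (f23 Δ) (f123 Γ[ Δ , Γ₀ ]))
                 g₁≡b₁ (facetCounts Δ Γ₀ Γ₀∈F r≡2)
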